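{- Let $k\ge 2$, let $G=(V,E)$ be a finite simple graph, let $v$ be a simplicial vertex of $G$ with neighborhood $N(v)$, and let $\Delta=\Delta^t_k(G)$. Then $\mathrm{del}_\Delta v$ is a pure simplicial complex generated by the facets of $\Delta^t_{k-1}(G\setminus v)$ that contain $N(v)$; that is, $\mathrm{del}_\Delta v = \mathrm{st}_{\Delta^t_{k-1}(G\setminus v)} N(v)$.
   Context: A vertex $v$ is simplicial if its neighborhood $N(v)$ is a clique. For $j\ge 1$, $\Delta_j^t(G)$ is the simplicial complex on $V(G)$ whose facets are the complements of independent sets of size $j$. $\mathrm{del}_\Delta v=\{\tau\in\Delta: v\notin\tau\}$ and $\mathrm{st}_\Delta\sigma=\{\tau\in\Delta:\sigma\cup\tau\in\Delta\}$. -}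

module Defs where

open import Data.Nat using (ℕ; _≤_)
open import Data.Bool using (Bool; true; false)
open import Data.Fin using (Fin)
open import Data.Fin.Subset using (Subset; _∈_; _∉_; _⊆_; _⊂_; _∪_; _─_; _-_; ⊤; ∣_∣)
open import Data.Vec using (tabulate)
open import Data.Product using (Σ; _×_; ∃)
open import Relation.Binary.PropositionalEquality using (_≡_; _≢_)
open import Relation.Unary using (Pred)
open import Level using (0ℓ)

record Graph (n : ℕ) : Set where
  field
    adj   : Fin n → Fin n → Bool
    sym   : ∀ x y → adj x y ≡ adj y x
    loopless : ∀ x → adj x x ≡ false
open Graph public

Complex : ℕ → Set₁
Complex n = Pred (Subset n) 0ℓ

N : ∀ {n} → Graph n → Fin n → Subset n
N G v = tabulate (adj G v)

IsClique : ∀ {n} → Graph n → Subset n → Set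
IsClique G S = ∀ x y → x ∈ S → y ∈ S → x ≢ y → adj G x y ≡ true

IsIndependent : ∀ {n} → Graph n → Subset n → Set
IsIndependent G I = ∀ x y → x ∈ I → y ∈ I → adj G x y ≡ false

Simplicial : ∀ {n} → Graph n → Fin n → Set
Simplicial G v = IsClique G (N G v)

-- Δ^t_j of the induced subgraph G[W] on vertex set W ⊆ Fin n:
-- the complex on W generated by the facets W ∖ I, I ⊆ W independent, |I| = j.
-- (Independence in G[W] of a set I ⊆ W is independence in G.)
ΔtOn : ∀ {n} → Graph n → Subset n → ℕ → Complex n
ΔtOn G W j σ =
  ∃ λ I → I ⊆ W × IsIndependent G I × ∣ I ∣ ≡ j × σ ⊆ (W ─ I)

Δt : ∀ {n} → Graph n → ℕ → Complex n
Δt G j = ΔtOn G ⊤ j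

ΔtDel : ∀ {n} → Graph n → Fin n → ℕ → Complex n
ΔtDel G v j = ΔtOn G (⊤ - v) j

del : ∀ {n} → Complex n → Fin n → Complex n
del Δ v τ = Δ τ × v ∉ τ

st : ∀ {n} → Complex n → Subset n → Complex n
st Δ σ τ = Δ (σ ∪ τ)

IsFacet : ∀ {n} → Complex n → Subset n → Set
IsFacet Δ σ = Δ σ × (∀ τ → Δ τ → σ ⊆ τ → τ ⊆ σ)

Pure : ∀ {n} → Complex n → Set
Pure Δ = ∀ σ τ → IsFacet Δ σ → IsFacet Δ τ → ∣ σ ∣ ≡ ∣ τ ∣

{-# OPTIONS --safe #-}
module Submission where

-- N[v] = {v} ∪ N(v) is a clique, so an independent k-set I meets it in at most one vertex u;
-- J = I ∖ u (for any u ∈ I if I misses N[v]) is then an independent (k−1)-set of G ∖ v avoiding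
-- N(v); a face τ ⊆ V ∖ I with v ∉ τ then lies in (V ∖ v) ∖ J.  Conversely J ∪ {v} is independent
-- whenever J avoids N[v], so (V ∖ v) ∖ J = V ∖ (J ∪ {v}) is a face of Δ.  Purity holds for the star
-- of any face in any Δ^t_j, as each of its faces lies in a face W ∖ I of size |W| − j.

open import Defs
open import Data.Nat using (ℕ; _≤_; _<_; _∸_; _+_; suc)
open import Data.Nat.Properties using (+-suc; m+n∸n≡m; m∸n+n≡m; <⇒≤)
open import Data.Fin using (Fin; zero; suc; _≟_)
open import Data.Fin.Subset
  using (Subset; _∈_; _∉_; _⊆_; _∪_; _∩_; _─_; _-_; ⊤; ⁅_⁆; ∣_∣; Nonempty; inside; outside)
open import Data.Fin.Subset.Properties
open import Data.Vec using ([]; _∷_; here; there)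
open import Data.Vec.Properties using (lookup∘tabulate; []=⇒lookup; lookup⇒[]=)
open import Data.Bool using (true; false)
open import Data.Product using (_×_; _,_; ∃)
open import Data.Sum using (inj₁; inj₂; [_,_])
open import Relation.Nullary using (yes; no; contradiction)
open import Relation.Binary.PropositionalEquality
  using (_≡_; _≢_; refl; trans; cong; cong₂; subst; module ≡-Reasoning)
  renaming (sym to ≡-sym)
open import Function.Bundles using (_⇔_; mk⇔; Equivalence)

private
  variable
    n : ℕ

x∈p─q⇒x∉q : (p q : Subset n) {x : Fin n} → x ∈ p ─ q → x ∉ q
x∈p─q⇒x∉q (_ ∷ p) (inside  ∷ q) {zero}  ()
x∈p─q⇒x∉q (_ ∷ p) (outside ∷ q) {zero}  here      ()
x∈p─q⇒x∉q (_ ∷ p) (_       ∷ q) {suc x} (there h) (there h′) = x∈p─q⇒x∉q p q h h′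

x∈p-y⇒x≢y : (p : Subset n) {x y : Fin n} → x ∈ p - y → x ≢ y
x∈p-y⇒x≢y p {y = y} h = x∉⁅y⁆⇒x≢y (x∈p─q⇒x∉q p ⁅ y ⁆ h)

∣p─q∣+∣q∣≡∣p∣ : (p q : Subset n) → q ⊆ p → ∣ p ─ q ∣ + ∣ q ∣ ≡ ∣ p ∣
∣p─q∣+∣q∣≡∣p∣ []            []            _   = refl
∣p─q∣+∣q∣≡∣p∣ (inside  ∷ p) (inside  ∷ q) q⊆p =
  trans (+-suc ∣ p ─ q ∣ ∣ q ∣) (cong suc (∣p─q∣+∣q∣≡∣p∣ p q (drop-∷-⊆ q⊆p)))
∣p─q∣+∣q∣≡∣p∣ (inside  ∷ p) (outside ∷ q) q⊆p = cong suc (∣p─q∣+∣q∣≡∣p∣ p q (drop-∷-⊆ q⊆p))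
∣p─q∣+∣q∣≡∣p∣ (outside ∷ p) (inside  ∷ q) q⊆p with () ← q⊆p here
∣p─q∣+∣q∣≡∣p∣ (outside ∷ p) (outside ∷ q) q⊆p = ∣p─q∣+∣q∣≡∣p∣ p q (drop-∷-⊆ q⊆p)

∣p∪q∣≡∣p∣+∣q∣ : (p q : Subset n) → (∀ {x} → x ∈ p → x ∉ q) → ∣ p ∪ q ∣ ≡ ∣ p ∣ + ∣ q ∣
∣p∪q∣≡∣p∣+∣q∣ []            []            _        = refl
∣p∪q∣≡∣p∣+∣q∣ (inside  ∷ p) (inside  ∷ q) disjoint = contradiction here (disjoint here)
∣p∪q∣≡∣p∣+∣q∣ (inside  ∷ p) (outside ∷ q) disjoint =
  cong suc (∣p∪q∣≡∣p∣+∣q∣ p q λ x∈p x∈q → disjoint (there x∈p) (there x∈q))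
∣p∪q∣≡∣p∣+∣q∣ (outside ∷ p) (inside  ∷ q) disjoint =
  trans (cong suc (∣p∪q∣≡∣p∣+∣q∣ p q λ x∈p x∈q → disjoint (there x∈p) (there x∈q)))
        (≡-sym (+-suc ∣ p ∣ ∣ q ∣))
∣p∪q∣≡∣p∣+∣q∣ (outside ∷ p) (outside ∷ q) disjoint =
  ∣p∪q∣≡∣p∣+∣q∣ p q λ x∈p x∈q → disjoint (there x∈p) (there x∈q)

0<∣p∣⇒Nonempty : (p : Subset n) → 0 < ∣ p ∣ → Nonempty p
0<∣p∣⇒Nonempty {n} p 0<∣p∣ with nonempty? p
... | yes ne  = ne
... | no  ¬ne with () ← subst (0 <_) (trans (cong ∣_∣ (Empty-unique ¬ne)) (∣⊥∣≡0 n)) 0<∣p∣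

removal-avoiding : (C I : Subset n) → Nonempty I →
  (∀ {x y} → x ∈ C → x ∈ I → y ∈ C → y ∈ I → x ≡ y) →
  ∃ λ u → u ∈ I × (∀ {x} → x ∈ I - u → x ∉ C)
removal-avoiding C I (w , w∈I) atMostOne with nonempty? (I ∩ C)
... | yes (u , u∈I∩C) = u , u∈I , λ x∈I-u x∈C →
        x∈p-y⇒x≢y I x∈I-u (atMostOne x∈C (p─q⊆p I ⁅ u ⁆ x∈I-u) u∈C u∈I)
  where
  u∈I : u ∈ I
  u∈I = p∩q⊆p I C u∈I∩C
  u∈C : u ∈ C
  u∈C = p∩q⊆q I C u∈I∩C
... | no  I∩C-empty = w , w∈I , λ x∈I-w x∈C →
        I∩C-empty (_ , x∈p∩q⁺ (p─q⊆p I ⁅ w ⁆ x∈I-w , x∈C))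

Pure-resp-⇔ : {Δ Δ′ : Complex n} → (∀ τ → Δ τ ⇔ Δ′ τ) → Pure Δ′ → Pure Δ
Pure-resp-⇔ {Δ = Δ} {Δ′} Δ⇔Δ′ pure σ τ σ-facet τ-facet =
  pure σ τ (transport σ-facet) (transport τ-facet)
  where
  open Equivalence
  transport : ∀ {σ} → IsFacet Δ σ → IsFacet Δ′ σ
  transport (Δσ , maximal) =
    to (Δ⇔Δ′ _) Δσ , λ τ Δ′τ σ⊆τ → maximal τ (from (Δ⇔Δ′ τ) Δ′τ) σ⊆τ

covered-by-size⇒Pure : {Δ : Complex n} (m : ℕ) →
  (∀ σ → Δ σ → ∃ λ F → Δ F × σ ⊆ F × ∣ F ∣ ≡ m) → Pure Δ
covered-by-size⇒Pure {Δ = Δ} m cover σ τ σ-facet τ-facet =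
  trans (facet-size σ σ-facet) (≡-sym (facet-size τ τ-facet))
  where
  facet-size : ∀ σ → IsFacet Δ σ → ∣ σ ∣ ≡ m
  facet-size σ (Δσ , maximal) with cover σ Δσ
  ... | F , ΔF , σ⊆F , ∣F∣≡m = subst (λ ρ → ∣ ρ ∣ ≡ m) (⊆-antisym (maximal F ΔF σ⊆F) σ⊆F) ∣F∣≡m

st-ΔtOn-pure : (G : Graph n) (W : Subset n) (j : ℕ) (σ : Subset n) → Pure (st (ΔtOn G W j) σ)
st-ΔtOn-pure G W j σ = covered-by-size⇒Pure (∣ W ∣ ∸ j) cover
  where
  cover : ∀ τ → st (ΔtOn G W j) σ τ → ∃ λ F → st (ΔtOn G W j) σ F × τ ⊆ F × ∣ F ∣ ≡ ∣ W ∣ ∸ j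
  cover τ (I , I⊆W , independent , ∣I∣≡j , σ∪τ⊆) =
    W ─ I , (I , I⊆W , independent , ∣I∣≡j , σ∪F⊆F) , (λ x∈τ → σ∪τ⊆ (q⊆p∪q σ τ x∈τ)) , ∣F∣
    where
    σ∪F⊆F : σ ∪ (W ─ I) ⊆ W ─ I
    σ∪F⊆F h with x∈p∪q⁻ σ (W ─ I) h
    ... | inj₁ x∈σ = σ∪τ⊆ (p⊆p∪q τ x∈σ)
    ... | inj₂ x∈F = x∈F
    ∣F∣ : ∣ W ─ I ∣ ≡ ∣ W ∣ ∸ j
    ∣F∣ = begin
      ∣ W ─ I ∣           ≡⟨ ≡-sym (m+n∸n≡m ∣ W ─ I ∣ j) ⟩
      ∣ W ─ I ∣ + j ∸ j   ≡⟨ cong (λ i → ∣ W ─ I ∣ + i ∸ j) (≡-sym ∣I∣≡j) ⟩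
      ∣ W ─ I ∣ + ∣ I ∣ ∸ j ≡⟨ cong (_∸ j) (∣p─q∣+∣q∣≡∣p∣ W I I⊆W) ⟩
      ∣ W ∣ ∸ j           ∎
      where open ≡-Reasoning

∈N⇔adj : (G : Graph n) (v x : Fin n) → x ∈ N G v ⇔ adj G v x ≡ true
∈N⇔adj G v x = mk⇔
  (λ x∈N → trans (≡-sym (lookup∘tabulate (adj G v) x)) ([]=⇒lookup x∈N))
  (λ adj≡true → lookup⇒[]= x _ (trans (lookup∘tabulate (adj G v) x) adj≡true))

∉N⇒¬adj : (G : Graph n) {v x : Fin n} → x ∉ N G v → adj G v x ≡ false
∉N⇒¬adj G {v} {x} x∉N with adj G v x in eq
... | true  = contradiction (Equivalence.from (∈N⇔adj G v x) eq) x∉N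
... | false = refl

v∉N : (G : Graph n) (v : Fin n) → v ∉ N G v
v∉N G v v∈N with () ← trans (≡-sym (Equivalence.to (∈N⇔adj G v v) v∈N)) (loopless G v)

Simplicial⇒closed-N-clique : (G : Graph n) {v : Fin n} → Simplicial G v →
  IsClique G (⁅ v ⁆ ∪ N G v)
Simplicial⇒closed-N-clique G {v} simplicial x y x∈ y∈ x≢y
  with x∈p∪q⁻ ⁅ v ⁆ (N G v) x∈ | x∈p∪q⁻ ⁅ v ⁆ (N G v) y∈
... | inj₁ x∈v | inj₁ y∈v = contradiction (trans (x∈⁅y⁆⇒x≡y v x∈v) (≡-sym (x∈⁅y⁆⇒x≡y v y∈v))) x≢y
... | inj₁ x∈v | inj₂ y∈N rewrite x∈⁅y⁆⇒x≡y v x∈v = Equivalence.to (∈N⇔adj G v y) y∈N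
... | inj₂ x∈N | inj₁ y∈v rewrite x∈⁅y⁆⇒x≡y v y∈v =
  trans (Graph.sym G x v) (Equivalence.to (∈N⇔adj G v x) x∈N)
... | inj₂ x∈N | inj₂ y∈N = simplicial x y x∈N y∈N x≢y

clique∩independent-unique : (G : Graph n) {C I : Subset n} → IsClique G C → IsIndependent G I →
  ∀ {x y} → x ∈ C → x ∈ I → y ∈ C → y ∈ I → x ≡ y
clique∩independent-unique G clique independent {x} {y} x∈C x∈I y∈C y∈I with x ≟ y
... | yes x≡y = x≡y
... | no  x≢y with () ← trans (≡-sym (clique x y x∈C y∈C x≢y)) (independent x y x∈I y∈I)

independent-⊆ : (G : Graph n) {I J : Subset n} → I ⊆ J → IsIndependent G J → IsIndependent G I
independent-⊆ G I⊆J independent x y x∈I y∈I = independent x y (I⊆J x∈I) (I⊆J y∈I)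

independent-∪⁅⁆ : (G : Graph n) {J : Subset n} {v : Fin n} → IsIndependent G J →
  (∀ {x} → x ∈ J → x ∉ N G v) → IsIndependent G (J ∪ ⁅ v ⁆)
independent-∪⁅⁆ G {J} {v} independent J∩N≡∅ x y x∈ y∈
  with x∈p∪q⁻ J ⁅ v ⁆ x∈ | x∈p∪q⁻ J ⁅ v ⁆ y∈
... | inj₁ x∈J | inj₁ y∈J = independent x y x∈J y∈J
... | inj₁ x∈J | inj₂ y∈v rewrite x∈⁅y⁆⇒x≡y v y∈v = trans (Graph.sym G x v) (∉N⇒¬adj G (J∩N≡∅ x∈J))
... | inj₂ x∈v | inj₁ y∈J rewrite x∈⁅y⁆⇒x≡y v x∈v = ∉N⇒¬adj G (J∩N≡∅ y∈J)
... | inj₂ x∈v | inj₂ y∈v rewrite x∈⁅y⁆⇒x≡y v x∈v | x∈⁅y⁆⇒x≡y v y∈v = loopless G v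

del-Δt⊆st-ΔtDel : ∀ {k} → 1 ≤ k → (G : Graph n) {v : Fin n} → Simplicial G v →
  ∀ τ → del (Δt G k) v τ → st (ΔtDel G v (k ∸ 1)) (N G v) τ
del-Δt⊆st-ΔtDel {k = k} 1≤k G {v} simplicial τ ((I , _ , independent , ∣I∣≡k , τ⊆) , v∉τ)
  with removal-avoiding (⁅ v ⁆ ∪ N G v) I (0<∣p∣⇒Nonempty I (subst (0 <_) (≡-sym ∣I∣≡k) 1≤k))
         (clique∩independent-unique G (Simplicial⇒closed-N-clique G simplicial) independent)
... | u , u∈I , avoids = I - u , J⊆⊤-v , independent-⊆ G J⊆I independent , ∣J∣≡k∸1 , N∪τ⊆
  where
  J⊆I : I - u ⊆ I
  J⊆I = p─q⊆p I ⁅ u ⁆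
  J⊆⊤-v : I - u ⊆ ⊤ - v
  J⊆⊤-v x∈J = x∈p∧x≢y⇒x∈p-y ∈⊤ λ { refl → avoids x∈J (p⊆p∪q (N G v) (x∈⁅x⁆ v)) }
  ∣J∣≡k∸1 : ∣ I - u ∣ ≡ k ∸ 1
  ∣J∣≡k∸1 = trans (≡-sym (m+n∸n≡m ∣ I - u ∣ 1))
    (cong (_∸ 1) (begin
      ∣ I - u ∣ + 1         ≡⟨ cong (∣ I - u ∣ +_) (≡-sym (∣⁅x⁆∣≡1 u)) ⟩
      ∣ I - u ∣ + ∣ ⁅ u ⁆ ∣ ≡⟨ ∣p─q∣+∣q∣≡∣p∣ I ⁅ u ⁆ (λ x∈u → subst (_∈ I) (≡-sym (x∈⁅y⁆⇒x≡y u x∈u)) u∈I) ⟩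
      ∣ I ∣                 ≡⟨ ∣I∣≡k ⟩
      k                     ∎))
    where open ≡-Reasoning
  N∪τ⊆ : N G v ∪ τ ⊆ (⊤ - v) ─ (I - u)
  N∪τ⊆ h with x∈p∪q⁻ (N G v) τ h
  ... | inj₁ x∈N = x∈p∧x∉q⇒x∈p─q (x∈p∧x≢y⇒x∈p-y ∈⊤ λ { refl → v∉N G v x∈N })
                                  (λ x∈J → avoids x∈J (q⊆p∪q ⁅ v ⁆ (N G v) x∈N))
  ... | inj₂ x∈τ = x∈p∧x∉q⇒x∈p─q (x∈p∧x≢y⇒x∈p-y ∈⊤ λ { refl → v∉τ x∈τ })
                                  (λ x∈J → x∈p─q⇒x∉q ⊤ I (τ⊆ x∈τ) (J⊆I x∈J))

st-ΔtDel⊆del-Δt : ∀ {k} → 1 ≤ k → (G : Graph n) {v : Fin n} →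
  ∀ τ → st (ΔtDel G v (k ∸ 1)) (N G v) τ → del (Δt G k) v τ
st-ΔtDel⊆del-Δt {k = k} 1≤k G {v} τ (J , J⊆⊤-v , independent , ∣J∣≡k∸1 , N∪τ⊆) =
  (J ∪ ⁅ v ⁆ , ⊆⊤ , independent-∪⁅⁆ G independent J∩N≡∅ , ∣J∪v∣≡k , τ⊆) , v∉τ
  where
  τ⊆F : ∀ {x} → x ∈ τ → x ∈ (⊤ - v) ─ J
  τ⊆F x∈τ = N∪τ⊆ (q⊆p∪q (N G v) τ x∈τ)
  J∩N≡∅ : ∀ {x} → x ∈ J → x ∉ N G v
  J∩N≡∅ x∈J x∈N = x∈p─q⇒x∉q (⊤ - v) J (N∪τ⊆ (p⊆p∪q τ x∈N)) x∈J
  ∣J∪v∣≡k : ∣ J ∪ ⁅ v ⁆ ∣ ≡ k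
  ∣J∪v∣≡k = begin
    ∣ J ∪ ⁅ v ⁆ ∣      ≡⟨ ∣p∪q∣≡∣p∣+∣q∣ J ⁅ v ⁆ (λ x∈J → x∈p─q⇒x∉q ⊤ ⁅ v ⁆ (J⊆⊤-v x∈J)) ⟩
    ∣ J ∣ + ∣ ⁅ v ⁆ ∣  ≡⟨ cong₂ _+_ ∣J∣≡k∸1 (∣⁅x⁆∣≡1 v) ⟩
    k ∸ 1 + 1         ≡⟨ m∸n+n≡m 1≤k ⟩
    k                 ∎
    where open ≡-Reasoning
  τ⊆ : τ ⊆ ⊤ ─ (J ∪ ⁅ v ⁆)
  τ⊆ {x} x∈τ = x∈p∧x∉q⇒x∈p─q ∈⊤ λ x∈J∪v → [ x∉J , x∉⁅v⁆ ] (x∈p∪q⁻ J ⁅ v ⁆ x∈J∪v)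
    where
    x∉J : x ∉ J
    x∉J = x∈p─q⇒x∉q (⊤ - v) J (τ⊆F x∈τ)
    x∉⁅v⁆ : x ∉ ⁅ v ⁆
    x∉⁅v⁆ = x≢y⇒x∉⁅y⁆ (x∈p-y⇒x≢y ⊤ (p─q⊆p (⊤ - v) J (τ⊆F x∈τ)))
  v∉τ : v ∉ τ
  v∉τ v∈τ = x∈p-y⇒x≢y ⊤ (p─q⊆p (⊤ - v) J (τ⊆F v∈τ)) refl

lemma3p5 : ∀ {n} (k : ℕ) → 2 ≤ k → (G : Graph n) (v : Fin n) → Simplicial G v →
    Pure (del (Δt G k) v)
    × (∀ (τ : Subset n) → del (Δt G k) v τ ⇔ st (ΔtDel G v (k ∸ 1)) (N G v) τ)
lemma3p5 k 2≤k G v simplicial =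
  Pure-resp-⇔ del⇔st (st-ΔtOn-pure G (⊤ - v) (k ∸ 1) (N G v)) , del⇔st
  where
  1≤k : 1 ≤ k
  1≤k = <⇒≤ 2≤k
  del⇔st : ∀ τ → del (Δt G k) v τ ⇔ st (ΔtDel G v (k ∸ 1)) (N G v) τ
  del⇔st τ = mk⇔ (del-Δt⊆st-ΔtDel 1≤k G simplicial τ) (st-ΔtDel⊆del-Δt 1≤k G τ)
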